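{- Let $(A,k)$ be an instance of \textsc{Unary Bin Packing} with $A=\{a_1,\dots,a_n\}$ and $B=\sum_{j\in[n]}a_j/k\in\mathbb N$, and let $(G,b)$ be the instance of \textsc{Bandwidth} constructed from it as described in the context. If $(A,k)$ is a YES-instance of \textsc{Unary Bin Packing}, then $(G,b)$ is a YES-instance of \textsc{Bandwidth}, i.e. $G$ has an ordering of stretch at most $b$.
   Context: \textsc{Unary Bin Packing}: given non-negative integers $A=\{a_1,\dots,a_n\}$ (encoded in unary) and $k\in\mathbb N$, decide whether there is a partition $(S_1,\dots,S_k)$ of $A$ with $\sum_{a_j\in S_i}a_j=\sum_{j\in[n]}a_j/k$ for every $i\in[k]$. An ordering of a graph $G$ is a bijection $\pi:V(G)\to[|V(G)|]$ with stretch $\max_{\{u,v\}\in E(G)}|\pi(u)-\pi(v)|$; $(G,b)$ is a YES-instance of \textsc{Bandwidth} if some ordering has stretch at most $b$. $[x,y]=\{x,\dots,y\}$, $[x]=[1,x]$. Construction: set $b=2kB+B-1$. (1) Boundary cliques: a clique $X$ on $x_1,\dots,x_{2kB+B}$ and a clique $Y$ on $y_1,\dots,y_{2kB+B}$. Let $X^i=\{x_{2iB-B+2},\dots,x_{2iB+B+1}\}$ for $i\in[k-1]$ and $X^k=\{x_{2kB-B+2},\dots,x_{2kB+B}\}$; let $Y^1=\{y_1,\dots,y_{3B-1}\}$ and $Y^i=\{y_{2iB-B},\dots,y_{2iB+B-1}\}$ for $i\in[2,k]$. (2) Delimiter cliques: for each $i\in[k]$ a clique on $L^i\cup R^i$ where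 $L^i=\{\ell^i_1,\dots,\ell^i_B\}$, $R^i=\{r^i_1,\dots,r^i_B\}$. Add edges: $\ell^i_1$ to every $x\in\bigcup_{j=i}^kX^j$ (for each $i\in[k]$); $x_{2iB+B+1}$ to every vertex of $L^i$ (for $i\in[k-1]$); $x_{2kB+B}$ to every vertex of $L^k$; $r^i_B$ to every $y\in\bigcup_{j=1}^iY^j$ (for each $i\in[k]$); $y_{2iB-B}$ to every vertex of $R^i$ (for $i\in[2,k]$); $y_1$ to every vertex of $R^1$. (3) Item cliques: for each $j\in[n]$ a clique $A^j$ on $A^{j,L}\cup A^{j,R}$ with $A^{j,L}=\{a^{j,L}_1,\dots,a^{j,L}_{a_j}\}$, $A^{j,R}=\{a^{j,R}_1,\dots,a^{j,R}_{a_j}\}$; add edges from $x_{2kB+B}$ to every vertex of $\bigcup_{j\in[n]}A^{j,L}$ and from $y_1$ to every vertex of $\bigcup_{j\in[n]}A^{j,R}$. There are no other vertices or edges. -}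

module Defs where

open import Data.Nat using (ℕ; zero; suc; _+_; _*_; _∸_; _≤_; _<_; ∣_-_∣)
open import Data.Fin using (Fin; toℕ)
open import Data.Product using (Σ; ∃; ∃-syntax; _×_; _,_)
open import Data.Sum using (_⊎_)
open import Relation.Binary.PropositionalEquality using (_≡_)
open import Relation.Nullary using (Dec; yes; no)
open import Function.Bundles using (_⤖_; Bijection)

sumFin : (n : ℕ) → (Fin n → ℕ) → ℕ
sumFin zero    f = 0
sumFin (suc n) f = f Data.Fin.zero + sumFin n (λ j → f (Data.Fin.suc j))

load : {n k : ℕ} → (a : Fin n → ℕ) → (σ : Fin n → Fin k) → Fin k → ℕ
load {n} a σ i = sumFin n (λ j → pick (σ j Data.Fin.≟ i) (a j))
  where
  pick : {P : Set} → Dec P → ℕ → ℕ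
  pick (yes _) m = m
  pick (no _)  _ = 0

-- The target value Σ_j a_j / k is passed as B (with k * B ≡ Σ_j a_j).
BinPackingYes : (n : ℕ) (a : Fin n → ℕ) (k B : ℕ) → Set
BinPackingYes n a k B = ∃[ σ ] (∀ (i : Fin k) → load a σ i ≡ B)

-- ordering = bijection V → [|V|] (here 0-based Fin m; any bijection onto
-- Fin m forces m = |V|); stretch ≤ b for every edge.
BandwidthYes : (V : Set) → (E : V → V → Set) → ℕ → Set
BandwidthYes V E b =
  ∃[ m ] Σ (V ⤖ Fin m) λ π →
    ∀ u v → E u v → ∣ toℕ (Bijection.to π u) - toℕ (Bijection.to π v) ∣ ≤ b

-- The construction.  All indices are 1-based as in the paper.

module Construction (k B n : ℕ) (a : Fin n → ℕ) where

  N : ℕ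
  N = 2 * k * B + B

  b : ℕ
  b = 2 * k * B + B ∸ 1

  data V : Set where
    x  : (i : ℕ) → 1 ≤ i → i ≤ N → V
    y  : (i : ℕ) → 1 ≤ i → i ≤ N → V
    ℓ  : (i t : ℕ) → 1 ≤ i → i ≤ k → 1 ≤ t → t ≤ B → V
    r  : (i t : ℕ) → 1 ≤ i → i ≤ k → 1 ≤ t → t ≤ B → V
    aL : (j : Fin n) (t : ℕ) → 1 ≤ t → t ≤ a j → V
    aR : (j : Fin n) (t : ℕ) → 1 ≤ t → t ≤ a j → V

  InX : ℕ → ℕ → Set
  InX m p = (m < k × 2 * m * B ∸ B + 2 ≤ p × p ≤ 2 * m * B + B + 1)
          ⊎ (m ≡ k × 2 * k * B ∸ B + 2 ≤ p × p ≤ 2 * k * B + B)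

  InY : ℕ → ℕ → Set
  InY m p = (m ≡ 1 × 1 ≤ p × p ≤ 3 * B ∸ 1)
          ⊎ (2 ≤ m × m ≤ k × 2 * m * B ∸ B ≤ p × p ≤ 2 * m * B + B ∸ 1)

  -- The edges of G (each undirected edge {u,v} is listed at least once,
  -- in some orientation; clique edges may also appear as loops u = u,
  -- which are irrelevant for the stretch).
  data E : V → V → Set where
    XX : ∀ {i p q j p' q'} → E (x i p q) (x j p' q')
    YY : ∀ {i p q j p' q'} → E (y i p q) (y j p' q')
    LL : ∀ {i t t' p q s u p' q' s' u'} → E (ℓ i t p q s u) (ℓ i t' p' q' s' u')
    LR : ∀ {i t t' p q s u p' q' s' u'} → E (ℓ i t p q s u) (r i t' p' q' s' u')
    RR : ∀ {i t t' p q s u p' q' s' u'} → E (r i t p q s u) (r i t' p' q' s' u')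
    L1X : ∀ {i p q s u j p' q'} (m : ℕ) → i ≤ m → m ≤ k → InX m j →
          E (ℓ i 1 p q s u) (x j p' q')
    XL : ∀ {j p' q' i t p q s u} → i < k → j ≡ 2 * i * B + B + 1 →
         E (x j p' q') (ℓ i t p q s u)
    XLk : ∀ {j p' q' i t p q s u} → i ≡ k → j ≡ 2 * k * B + B →
          E (x j p' q') (ℓ i t p q s u)
    RBY : ∀ {i t p q s u j p' q'} (m : ℕ) → t ≡ B → 1 ≤ m → m ≤ i → InY m j →
          E (r i t p q s u) (y j p' q')
    YR : ∀ {j p' q' i t p q s u} → 2 ≤ i → j ≡ 2 * i * B ∸ B →
         E (y j p' q') (r i t p q s u)
    YR1 : ∀ {j p' q' i t p q s u} → i ≡ 1 → j ≡ 1 →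
          E (y j p' q') (r i t p q s u)
    AA-LL : ∀ {j t t' p q p' q'} → E (aL j t p q) (aL j t' p' q')
    AA-LR : ∀ {j t t' p q p' q'} → E (aL j t p q) (aR j t' p' q')
    AA-RR : ∀ {j t t' p q p' q'} → E (aR j t p q) (aR j t' p' q')
    XAL : ∀ {i p q j t p' q'} → i ≡ 2 * k * B + B → E (x i p q) (aL j t p' q')
    YAR : ∀ {i p q j t p' q'} → i ≡ 1 → E (y i p q) (aR j t p' q')

module Submission where

-- Fix a packing and order G as: X, then for every bin i the left halves of
-- the items packed into i followed by L^i, then the same with the right
-- halves and R^i, then Y.  Since every bin holds exactly B, bin i occupies a
-- window of width 2B in each half, so the two halves of an item clique or of
-- a delimiter clique lie exactly 2kB apart, and every such clique fits in
-- N = 2kB + B = b + 1 consecutive positions.  The remaining edges run from X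
-- into the left half and from Y into the right half, and the index ranges of
-- the X^m and Y^m are exactly what keeps those shorter than N as well.

open import Defs
open import Data.Nat using (ℕ; zero; suc; _+_; _*_; _∸_; _≤_; _<_; z≤n; s≤s; s≤s⁻¹; ∣_-_∣)
open import Data.Nat.Properties hiding (_≟_)
open import Data.Nat.Tactic.RingSolver using (solve)
open import Algebra.Properties.CommutativeSemigroup +-commutativeSemigroup using (x∙yz≈y∙xz)
open import Data.List using (_∷_; [])
open import Data.Fin as Fin using (Fin; toℕ; fromℕ<; _≟_)
open import Data.Fin.Properties
  using (+↔⊎; *↔×; toℕ-↑ˡ; toℕ-↑ʳ; toℕ-combine; toℕ-fromℕ<; fromℕ<-toℕ; toℕ<n)
open import Data.Product using (Σ; _×_; _,_)
open import Data.Sum using (_⊎_; inj₁; inj₂)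
open import Data.Empty using (⊥-elim)
open import Data.Empty.Polymorphic using (⊥)
open import Level using (0ℓ)
open import Function using (_∘_)
open import Function.Bundles using (_↔_; mk↔ₛ′; Inverse)
open import Function.Properties.Inverse using (↔-sym; ↔-trans; ↔-refl; ↔⇒⤖)
open import Function.Related.TypeIsomorphisms using (⊎-identityˡ)
open import Data.Sum.Function.Propositional using (_⊎-↔_)
open import Data.Product.Function.Dependent.Propositional using (Σ-↔)
open import Relation.Binary.PropositionalEquality
open import Relation.Nullary using (¬_; yes; no)
import Axiom.UniquenessOfIdentityProofs as UIP

<⇒≤∸1 : ∀ {m n} → m < n → m ≤ n ∸ 1
<⇒≤∸1 (s≤s m≤n) = m≤n

m,n<o⇒∣m-n∣≤o∸1 : ∀ {m n o} → m < o → n < o → ∣ m - n ∣ ≤ o ∸ 1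
m,n<o⇒∣m-n∣≤o∸1 {m} {n} (s≤s m≤o) (s≤s n≤o) = ≤-trans (∣m-n∣≤m⊔n m n) (⊔-lub m≤o n≤o)

m≤n<m+o⇒∣m-n∣≤o∸1 : ∀ {m n o} → m ≤ n → n < m + o → ∣ m - n ∣ ≤ o ∸ 1
m≤n<m+o⇒∣m-n∣≤o∸1 {m} {n} {o} m≤n n<m+o = <⇒≤∸1 (begin-strict
  ∣ m - n ∣  ≡⟨ m≤n⇒∣m-n∣≡n∸m m≤n ⟩
  n ∸ m      <⟨ ∸-monoˡ-< n<m+o m≤n ⟩
  m + o ∸ m  ≡⟨ m+n∸m≡n m o ⟩
  o          ∎)
  where open ≤-Reasoning

∣l+m-l+n∣≤o : ∀ l {m n o} → ∣ m - n ∣ ≤ o → ∣ l + m - l + n ∣ ≤ o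
∣l+m-l+n∣≤o l {m} {n} = subst (_≤ _) (sym (∣m+n-m+o∣≡∣n-o∣ l m n))

∣l+m-k+[l+n]∣≤o : ∀ l k {m n o} → ∣ m - k + n ∣ ≤ o → ∣ l + m - k + (l + n) ∣ ≤ o
∣l+m-k+[l+n]∣≤o l k {m} {n} {o} d =
  subst (λ z → ∣ l + m - z ∣ ≤ o) (sym (x∙yz≈y∙xz k l n)) (∣l+m-l+n∣≤o l d)

Σ-suc↔⊎ : ∀ {n} {P : Fin (suc n) → Set} →
          Σ (Fin (suc n)) P ↔ (P Fin.zero ⊎ Σ (Fin n) (P ∘ Fin.suc))
Σ-suc↔⊎ {n} {P} = mk↔ₛ′ to from to∘from from∘to
  where
  to : Σ (Fin (suc n)) P → P Fin.zero ⊎ Σ (Fin n) (P ∘ Fin.suc)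
  to (Fin.zero  , p) = inj₁ p
  to (Fin.suc j , p) = inj₂ (j , p)

  from : P Fin.zero ⊎ Σ (Fin n) (P ∘ Fin.suc) → Σ (Fin (suc n)) P
  from (inj₁ p)       = Fin.zero , p
  from (inj₂ (j , p)) = Fin.suc j , p

  to∘from : ∀ z → to (from z) ≡ z
  to∘from (inj₁ _) = refl
  to∘from (inj₂ _) = refl

  from∘to : ∀ z → from (to z) ≡ z
  from∘to (Fin.zero  , _) = refl
  from∘to (Fin.suc _ , _) = refl

module _ {k : ℕ} {A : Set} {i i' : Fin k} where

  ≡-×↔ : i ≡ i' → (i ≡ i' × A) ↔ A
  ≡-×↔ i≡i' = mk↔ₛ′ (λ (_ , z) → z) (i≡i' ,_) (λ _ → refl)
    (λ (e , z) → cong (_, z) (UIP.Decidable⇒UIP.≡-irrelevant _≟_ i≡i' e))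

  ≢-×↔⊥ : ¬ i ≡ i' → (i ≡ i' × A) ↔ ⊥ {0ℓ}
  ≢-×↔⊥ i≢i' = mk↔ₛ′ (λ (e , _) → ⊥-elim (i≢i' e)) (λ ()) (λ ()) (λ (e , _) → ⊥-elim (i≢i' e))

⊎↔+ : ∀ {A C : Set} {m p} → A ↔ Fin m → C ↔ Fin p → (A ⊎ C) ↔ Fin (m + p)
⊎↔+ A↔m C↔p = ↔-trans (A↔m ⊎-↔ C↔p) (↔-sym +↔⊎)

Σ↔* : ∀ {k m} {P : Fin k → Set} → (∀ i → P i ↔ Fin m) → Σ (Fin k) P ↔ Fin (k * m)
Σ↔* P↔m = ↔-trans (Σ-↔ ↔-refl (λ {i} → P↔m i)) (↔-sym *↔×)

assigned↔load : ∀ {n k} (a : Fin n → ℕ) (σ : Fin n → Fin k) (i : Fin k) →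
                Σ (Fin n) (λ j → σ j ≡ i × Fin (a j)) ↔ Fin (load a σ i)
assigned↔load {zero}  a σ i = mk↔ₛ′ (λ ()) (λ ()) (λ ()) (λ ())
assigned↔load {suc n} a σ i with σ Fin.zero ≟ i
... | yes σ₀≡i = ↔-trans Σ-suc↔⊎ (⊎↔+ (≡-×↔ σ₀≡i) (assigned↔load (a ∘ Fin.suc) (σ ∘ Fin.suc) i))
... | no  σ₀≢i = ↔-trans Σ-suc↔⊎
  (↔-trans (≢-×↔⊥ σ₀≢i ⊎-↔ assigned↔load (a ∘ Fin.suc) (σ ∘ Fin.suc) i) (⊎-identityˡ 0ℓ _))

module Widths (k B : ℕ) where

  W : ℕ
  W = B + B

  KW : ℕ
  KW = k * W

  N : ℕ
  N = 2 * k * B + B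

  N≡KW+B : N ≡ KW + B
  N≡KW+B = expanded
    where
    expanded : 2 * k * B + B ≡ k * (B + B) + B
    expanded = solve (k ∷ B ∷ [])

  2[1+i]B≡W*i+W : ∀ i → 2 * suc i * B ≡ W * i + W
  2[1+i]B≡W*i+W i = expanded
    where
    expanded : 2 * suc i * B ≡ (B + B) * i + (B + B)
    expanded = solve (i ∷ B ∷ [])

  W*i+W∸B≡W*i+B : ∀ i → W * i + W ∸ B ≡ W * i + B
  W*i+W∸B≡W*i+B i = trans (cong (_∸ B) (sym (+-assoc (W * i) B B))) (m+n∸n≡m (W * i + B) B)

  <B⇒<N : ∀ {t} → t < B → t < N
  <B⇒<N t<B = <-≤-trans t<B (m≤n+m B (2 * k * B))

  <B⇒KW+<N : ∀ {t} → t < B → KW + t < N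
  <B⇒KW+<N {t} t<B = subst (KW + t <_) (sym N≡KW+B) (+-monoʳ-< KW t<B)

  within-block : ∀ {t t'} → t < B → t' < B → ∣ t - t' ∣ ≤ N ∸ 1
  within-block t<B t'<B = m,n<o⇒∣m-n∣≤o∸1 (<B⇒<N t<B) (<B⇒<N t'<B)

  across-halves : ∀ {t t'} → t < B → t' < B → ∣ t - KW + t' ∣ ≤ N ∸ 1
  across-halves t<B t'<B = m,n<o⇒∣m-n∣≤o∸1 (<B⇒<N t<B) (<B⇒KW+<N t'<B)

  window<KW : ∀ {s o} → s < k → o < W → W * s + o < KW
  window<KW {s} {o} s<k o<W = begin-strict
    W * s + o  <⟨ +-monoʳ-< (W * s) o<W ⟩
    W * s + W  ≡⟨ +-comm (W * s) W ⟩
    W + W * s  ≡⟨ *-suc W s ⟨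
    W * suc s  ≤⟨ *-monoʳ-≤ W s<k ⟩
    W * k      ≡⟨ *-comm W k ⟩
    KW         ∎
    where open ≤-Reasoning

  near-X : ∀ {p δ} → p < N → δ < p → ∣ p - N + δ ∣ ≤ N ∸ 1
  near-X {p} {δ} p<N δ<p = m≤n<m+o⇒∣m-n∣≤o∸1 (≤-trans (<⇒≤ p<N) (m≤m+n N δ)) (begin-strict
    N + δ  <⟨ +-monoʳ-< N δ<p ⟩
    N + p  ≡⟨ +-comm N p ⟩
    p + N  ∎)
    where open ≤-Reasoning

  near-Y : ∀ {δ p} → δ < KW → p < δ + B → ∣ δ - KW + p ∣ ≤ N ∸ 1
  near-Y {δ} {p} δ<KW p<δ+B = m≤n<m+o⇒∣m-n∣≤o∸1 (≤-trans (<⇒≤ δ<KW) (m≤m+n KW p)) (begin-strict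
    KW + p        <⟨ +-monoʳ-< KW p<δ+B ⟩
    KW + (δ + B)  ≡⟨ x∙yz≈y∙xz KW δ B ⟩
    δ + (KW + B)  ≡⟨ cong (δ +_) N≡KW+B ⟨
    δ + N         ∎)
    where open ≤-Reasoning

  near-last-x : ∀ {p δ} → suc p ≡ N → 0 < B → δ < KW → ∣ p - N + δ ∣ ≤ N ∸ 1
  near-last-x {p} 1+p≡N 0<B δ<KW = near-X (subst (p <_) 1+p≡N ≤-refl) (<-≤-trans δ<KW KW≤p)
    where
    open ≤-Reasoning
    KW≤p : KW ≤ p
    KW≤p = s≤s⁻¹ (begin
      suc KW  ≤⟨ m<m+n KW 0<B ⟩
      KW + B  ≡⟨ N≡KW+B ⟨
      N       ≡⟨ 1+p≡N ⟨
      suc p   ∎)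

  near-first-y : ∀ {δ} → 0 < B → δ < KW → ∣ δ - KW + 0 ∣ ≤ N ∸ 1
  near-first-y {δ} 0<B δ<KW = near-Y δ<KW (<-≤-trans 0<B (m≤n+m B δ))

  first-delimiter<X : ∀ {i m p} → suc i ≤ m → 2 * m * B ∸ B + 2 ≤ suc p → W * i + (B + 0) < p
  first-delimiter<X {i} {m} {p} 1+i≤m X≤1+p = begin-strict
    W * i + (B + 0)    ≡⟨ cong (W * i +_) (+-identityʳ B) ⟩
    W * i + B          ≡⟨ W*i+W∸B≡W*i+B i ⟨
    W * i + W ∸ B      ≡⟨ cong (_∸ B) (2[1+i]B≡W*i+W i) ⟨
    2 * suc i * B ∸ B  ≤⟨ ∸-monoˡ-≤ B (*-monoˡ-≤ B (*-monoʳ-≤ 2 1+i≤m)) ⟩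
    2 * m * B ∸ B      <⟨ s≤s⁻¹ (subst (_≤ suc p) (+-comm (2 * m * B ∸ B) 2) X≤1+p) ⟩
    p                  ∎
    where open ≤-Reasoning

  delimiter<x : ∀ {i t p} → t < B → suc p ≡ 2 * suc i * B + B + 1 → W * i + (B + t) < p
  delimiter<x {i} {t} {p} t<B 1+p≡ = begin-strict
    W * i + (B + t)    <⟨ +-monoʳ-< (W * i) (+-monoʳ-< B t<B) ⟩
    W * i + W          ≡⟨ 2[1+i]B≡W*i+W i ⟨
    2 * suc i * B      ≤⟨ m≤m+n (2 * suc i * B) B ⟩
    2 * suc i * B + B  ≡⟨ suc-injective (trans 1+p≡ (+-comm _ 1)) ⟨
    p                  ∎
    where open ≤-Reasoning

  y<last-delimiter : ∀ {i t m p} → suc t ≡ B → m ≤ suc i → suc p ≤ 2 * m * B + B ∸ 1 →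
                     p < W * i + (B + t) + B
  y<last-delimiter {i} {t} {m} {p} 1+t≡B m≤1+i Y≥1+p = begin
    suc p                          ≤⟨ Y≥1+p ⟩
    2 * m * B + B ∸ 1              ≤⟨ ∸-monoˡ-≤ 1 (+-monoˡ-≤ B (*-monoˡ-≤ B (*-monoʳ-≤ 2 m≤1+i))) ⟩
    2 * suc i * B + B ∸ 1          ≡⟨ cong (λ z → z + B ∸ 1) (2[1+i]B≡W*i+W i) ⟩
    W * i + (B + B) + B ∸ 1        ≡⟨ cong (λ z → W * i + (B + z) + B ∸ 1) 1+t≡B ⟨
    W * i + (B + suc t) + B ∸ 1    ≡⟨ cong (λ z → W * i + z + B ∸ 1) (+-suc B t) ⟩
    W * i + suc (B + t) + B ∸ 1    ≡⟨ cong (λ z → z + B ∸ 1) (+-suc (W * i) (B + t)) ⟩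
    W * i + (B + t) + B            ∎
    where open ≤-Reasoning

  y<delimiter : ∀ {i t p} → suc p ≡ 2 * suc i * B ∸ B → p < W * i + (B + t) + B
  y<delimiter {i} {t} {p} 1+p≡ = begin
    suc p                ≡⟨ 1+p≡ ⟩
    2 * suc i * B ∸ B    ≡⟨ cong (_∸ B) (2[1+i]B≡W*i+W i) ⟩
    W * i + W ∸ B        ≡⟨ W*i+W∸B≡W*i+B i ⟩
    W * i + B            ≤⟨ +-monoʳ-≤ (W * i) (m≤m+n B t) ⟩
    W * i + (B + t)      ≤⟨ m≤m+n (W * i + (B + t)) B ⟩
    W * i + (B + t) + B  ∎
    where open ≤-Reasoning

module Ordering {n : ℕ} (a : Fin n → ℕ) (k B : ℕ) (σ : Fin n → Fin k)
                (σ-fills : ∀ i → load a σ i ≡ B) where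

  open Construction k B n a
  open Widths k B hiding (N)

  Items : Fin k → Set
  Items i = Σ (Fin n) λ j → σ j ≡ i × Fin (a j)

  item : ∀ {j t} → t < a j → Items (σ j)
  item {j} t<aⱼ = j , refl , fromℕ< t<aⱼ

  items↔ : ∀ i → Items i ↔ Fin B
  items↔ i = subst (λ m → Items i ↔ Fin m) (σ-fills i) (assigned↔load a σ i)

  offset : ∀ i → Items i → ℕ
  offset i z = toℕ (Inverse.to (items↔ i) z)

  offset<B : ∀ {i} z → offset i z < B
  offset<B {i} z = toℕ<n (Inverse.to (items↔ i) z)

  offset<W : ∀ {i} z → offset i z < W
  offset<W z = <-≤-trans (offset<B z) (m≤m+n B B)

  -- In each half, bin i is a window of width W: its items, then its delimiter block.
  Half : Set
  Half = Σ (Fin k) λ i → Items i ⊎ Fin B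

  Layout : Set
  Layout = Fin N ⊎ (Half ⊎ (Half ⊎ Fin N))

  half↔ : Half ↔ Fin KW
  half↔ = Σ↔* λ i → ⊎↔+ (items↔ i) ↔-refl

  layout↔ : Layout ↔ Fin (N + (KW + (KW + N)))
  layout↔ = ⊎↔+ ↔-refl (⊎↔+ half↔ (⊎↔+ half↔ ↔-refl))

  toLayout : V → Layout
  toLayout (x  (suc p) _ p<N)              = inj₁ (fromℕ< p<N)
  toLayout (aL j (suc t) _ t<aⱼ)           = inj₂ (inj₁ (σ j , inj₁ (item t<aⱼ)))
  toLayout (ℓ  (suc i) (suc t) _ i<k _ t<B) = inj₂ (inj₁ (fromℕ< i<k , inj₂ (fromℕ< t<B)))
  toLayout (aR j (suc t) _ t<aⱼ)           = inj₂ (inj₂ (inj₁ (σ j , inj₁ (item t<aⱼ))))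
  toLayout (r  (suc i) (suc t) _ i<k _ t<B) = inj₂ (inj₂ (inj₁ (fromℕ< i<k , inj₂ (fromℕ< t<B))))
  toLayout (y  (suc p) _ p<N)              = inj₂ (inj₂ (inj₂ (fromℕ< p<N)))

  fromHalf : (∀ j t → 1 ≤ t → t ≤ a j → V) → (∀ i t → 1 ≤ i → i ≤ k → 1 ≤ t → t ≤ B → V) →
             Half → V
  fromHalf item-vertex _ (_ , inj₁ (j , _ , u)) = item-vertex j (suc (toℕ u)) (s≤s z≤n) (toℕ<n u)
  fromHalf _ delimiter-vertex (i , inj₂ t) =
    delimiter-vertex (suc (toℕ i)) (suc (toℕ t)) (s≤s z≤n) (toℕ<n i) (s≤s z≤n) (toℕ<n t)

  fromLayout : Layout → V
  fromLayout (inj₁ u)                = x (suc (toℕ u)) (s≤s z≤n) (toℕ<n u)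
  fromLayout (inj₂ (inj₁ h))         = fromHalf aL ℓ h
  fromLayout (inj₂ (inj₂ (inj₁ h)))  = fromHalf aR r h
  fromLayout (inj₂ (inj₂ (inj₂ u)))  = y (suc (toℕ u)) (s≤s z≤n) (toℕ<n u)

  toLayout∘fromLayout : ∀ z → toLayout (fromLayout z) ≡ z
  toLayout∘fromLayout (inj₁ u) = cong inj₁ (fromℕ<-toℕ u _)
  toLayout∘fromLayout (inj₂ (inj₁ (_ , inj₁ (j , refl , u)))) =
    cong (λ w → inj₂ (inj₁ (σ j , inj₁ (j , refl , w)))) (fromℕ<-toℕ u _)
  toLayout∘fromLayout (inj₂ (inj₁ (i , inj₂ t))) =
    cong₂ (λ i t → inj₂ (inj₁ (i , inj₂ t))) (fromℕ<-toℕ i _) (fromℕ<-toℕ t _)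
  toLayout∘fromLayout (inj₂ (inj₂ (inj₁ (_ , inj₁ (j , refl , u))))) =
    cong (λ w → inj₂ (inj₂ (inj₁ (σ j , inj₁ (j , refl , w))))) (fromℕ<-toℕ u _)
  toLayout∘fromLayout (inj₂ (inj₂ (inj₁ (i , inj₂ t)))) =
    cong₂ (λ i t → inj₂ (inj₂ (inj₁ (i , inj₂ t)))) (fromℕ<-toℕ i _) (fromℕ<-toℕ t _)
  toLayout∘fromLayout (inj₂ (inj₂ (inj₂ u))) = cong (inj₂ ∘ inj₂ ∘ inj₂) (fromℕ<-toℕ u _)

  boundary-≡ : ∀ (c : ∀ p → 1 ≤ p → p ≤ N → V) {p p' h h' q q'} → p ≡ p' → c p h q ≡ c p' h' q'
  boundary-≡ c refl = cong₂ (c _) (≤-irrelevant _ _) (≤-irrelevant _ _)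

  item-≡ : ∀ (c : ∀ j t → 1 ≤ t → t ≤ a j → V) {j t t' h h' q q'} →
           t ≡ t' → c j t h q ≡ c j t' h' q'
  item-≡ c refl = cong₂ (c _ _) (≤-irrelevant _ _) (≤-irrelevant _ _)

  delimiter-≡ : ∀ (c : ∀ i t → 1 ≤ i → i ≤ k → 1 ≤ t → t ≤ B → V)
                {i i' t t' h₁ h₁' h₂ h₂' h₃ h₃' h₄ h₄'} →
                i ≡ i' → t ≡ t' → c i t h₁ h₂ h₃ h₄ ≡ c i' t' h₁' h₂' h₃' h₄'
  delimiter-≡ c refl refl = cong₂ (λ (h₁ , h₂) (h₃ , h₄) → c _ _ h₁ h₂ h₃ h₄)
    (cong₂ _,_ (≤-irrelevant _ _) (≤-irrelevant _ _))
    (cong₂ _,_ (≤-irrelevant _ _) (≤-irrelevant _ _))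

  fromLayout∘toLayout : ∀ v → fromLayout (toLayout v) ≡ v
  fromLayout∘toLayout (x  (suc p) _ p<N)              = boundary-≡ x (cong suc (toℕ-fromℕ< p<N))
  fromLayout∘toLayout (aL j (suc t) _ t<aⱼ)           = item-≡ aL (cong suc (toℕ-fromℕ< t<aⱼ))
  fromLayout∘toLayout (ℓ  (suc i) (suc t) _ i<k _ t<B) =
    delimiter-≡ ℓ (cong suc (toℕ-fromℕ< i<k)) (cong suc (toℕ-fromℕ< t<B))
  fromLayout∘toLayout (aR j (suc t) _ t<aⱼ)           = item-≡ aR (cong suc (toℕ-fromℕ< t<aⱼ))
  fromLayout∘toLayout (r  (suc i) (suc t) _ i<k _ t<B) =
    delimiter-≡ r (cong suc (toℕ-fromℕ< i<k)) (cong suc (toℕ-fromℕ< t<B))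
  fromLayout∘toLayout (y  (suc p) _ p<N)              = boundary-≡ y (cong suc (toℕ-fromℕ< p<N))

  ordering : V ↔ Fin (N + (KW + (KW + N)))
  ordering = ↔-trans (mk↔ₛ′ toLayout fromLayout toLayout∘fromLayout fromLayout∘toLayout) layout↔

  slot : Layout → ℕ
  slot = toℕ ∘ Inverse.to layout↔

  pos : V → ℕ
  pos v = toℕ (Inverse.to ordering v)

  slot-x : ∀ {p} (p<N : p < N) → slot (inj₁ (fromℕ< p<N)) ≡ p
  slot-x p<N = trans (toℕ-↑ˡ (fromℕ< p<N) _) (toℕ-fromℕ< p<N)

  slot-y : ∀ {p} (p<N : p < N) → slot (inj₂ (inj₂ (inj₂ (fromℕ< p<N)))) ≡ N + (KW + (KW + p))
  slot-y p<N = trans (toℕ-↑ʳ N _) (cong (N +_) (trans (toℕ-↑ʳ KW _) (cong (KW +_)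
    (trans (toℕ-↑ʳ KW _) (cong (KW +_) (toℕ-fromℕ< p<N))))))

  L-slot : ∀ h → slot (inj₂ (inj₁ h)) ≡ N + toℕ (Inverse.to half↔ h)
  L-slot h = trans (toℕ-↑ʳ N _) (cong (N +_) (toℕ-↑ˡ (Inverse.to half↔ h) _))

  R-slot : ∀ h → slot (inj₂ (inj₂ (inj₁ h))) ≡ N + (KW + toℕ (Inverse.to half↔ h))
  R-slot h = trans (toℕ-↑ʳ N _)
    (cong (N +_) (trans (toℕ-↑ʳ KW _) (cong (KW +_) (toℕ-↑ˡ (Inverse.to half↔ h) _))))

  item-offset : ∀ i z → toℕ (Inverse.to half↔ (i , inj₁ z)) ≡ W * toℕ i + offset i z
  item-offset i z =
    trans (toℕ-combine i _) (cong (W * toℕ i +_) (toℕ-↑ˡ (Inverse.to (items↔ i) z) B))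

  delimiter-offset : ∀ {i t} (i<k : i < k) (t<B : t < B) →
                     toℕ (Inverse.to half↔ (fromℕ< i<k , inj₂ (fromℕ< t<B))) ≡ W * i + (B + t)
  delimiter-offset i<k t<B = trans (toℕ-combine (fromℕ< i<k) _)
    (cong₂ (λ i o → W * i + o) (toℕ-fromℕ< i<k) (trans (toℕ-↑ʳ B _) (cong (B +_) (toℕ-fromℕ< t<B))))

  slot-ℓ : ∀ {i t} (i<k : i < k) (t<B : t < B) →
           slot (inj₂ (inj₁ (fromℕ< i<k , inj₂ (fromℕ< t<B)))) ≡ N + (W * i + (B + t))
  slot-ℓ i<k t<B =
    trans (L-slot (fromℕ< i<k , inj₂ (fromℕ< t<B))) (cong (N +_) (delimiter-offset i<k t<B))

  slot-r : ∀ {i t} (i<k : i < k) (t<B : t < B) →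
           slot (inj₂ (inj₂ (inj₁ (fromℕ< i<k , inj₂ (fromℕ< t<B))))) ≡ N + (KW + (W * i + (B + t)))
  slot-r i<k t<B = trans (R-slot (fromℕ< i<k , inj₂ (fromℕ< t<B)))
    (cong (λ o → N + (KW + o)) (delimiter-offset i<k t<B))

  slot-aL : ∀ {i} z → slot (inj₂ (inj₁ (i , inj₁ z))) ≡ N + (W * toℕ i + offset i z)
  slot-aL {i} z = trans (L-slot (i , inj₁ z)) (cong (N +_) (item-offset i z))

  slot-aR : ∀ {i} z → slot (inj₂ (inj₂ (inj₁ (i , inj₁ z)))) ≡ N + (KW + (W * toℕ i + offset i z))
  slot-aR {i} z = trans (R-slot (i , inj₁ z)) (cong (λ o → N + (KW + o)) (item-offset i z))

  X-start : ∀ {m p} → InX m p → 2 * m * B ∸ B + 2 ≤ p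
  X-start (inj₁ (_ , start≤p , _))    = start≤p
  X-start (inj₂ (refl , start≤p , _)) = start≤p

  Y-end : ∀ {m p} → InY m p → p ≤ 2 * m * B + B ∸ 1
  Y-end {p = p} (inj₁ (refl , _ , p≤end)) = subst (λ e → p ≤ e ∸ 1) 3B≡2*1*B+B p≤end
    where
    3B≡2*1*B+B : 3 * B ≡ 2 * 1 * B + B
    3B≡2*1*B+B = solve (B ∷ [])
  Y-end (inj₂ (_ , _ , _ , p≤end)) = p≤end

  via : ∀ u v {P Q} → pos u ≡ P → pos v ≡ Q → ∣ P - Q ∣ ≤ N ∸ 1 → ∣ pos u - pos v ∣ ≤ b
  via _ _ refl refl d = d

  via′ : ∀ u v {P Q} → pos u ≡ P → pos v ≡ Q → ∣ Q - P ∣ ≤ N ∸ 1 → ∣ pos u - pos v ∣ ≤ b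
  via′ u v refl refl = subst (_≤ N ∸ 1) (∣-∣-comm (pos v) (pos u))

  stretch : ∀ u v → E u v → ∣ pos u - pos v ∣ ≤ b
  stretch u@(x (suc p) _ p<N) v@(x (suc p') _ p'<N) XX =
    via u v (slot-x p<N) (slot-x p'<N) (m,n<o⇒∣m-n∣≤o∸1 p<N p'<N)
  stretch u@(y (suc p) _ p<N) v@(y (suc p') _ p'<N) YY =
    via u v (slot-y p<N) (slot-y p'<N)
      (∣l+m-l+n∣≤o N (∣l+m-l+n∣≤o KW (∣l+m-l+n∣≤o KW (m,n<o⇒∣m-n∣≤o∸1 p<N p'<N))))
  stretch u@(ℓ (suc i) (suc t) _ i<k _ t<B) v@(ℓ _ (suc t') _ _ _ t'<B) LL =
    via u v (slot-ℓ i<k t<B) (slot-ℓ i<k t'<B)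
      (∣l+m-l+n∣≤o N (∣l+m-l+n∣≤o (W * i) (∣l+m-l+n∣≤o B (within-block t<B t'<B))))
  stretch u@(ℓ (suc i) (suc t) _ i<k _ t<B) v@(r _ (suc t') _ _ _ t'<B) LR =
    via u v (slot-ℓ i<k t<B) (slot-r i<k t'<B)
      (∣l+m-l+n∣≤o N (∣l+m-k+[l+n]∣≤o (W * i) KW (∣l+m-k+[l+n]∣≤o B KW (across-halves t<B t'<B))))
  stretch u@(r (suc i) (suc t) _ i<k _ t<B) v@(r _ (suc t') _ _ _ t'<B) RR =
    via u v (slot-r i<k t<B) (slot-r i<k t'<B)
      (∣l+m-l+n∣≤o N (∣l+m-l+n∣≤o KW (∣l+m-l+n∣≤o (W * i) (∣l+m-l+n∣≤o B (within-block t<B t'<B)))))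
  stretch u@(aL j (suc t) _ t<aⱼ) v@(aL _ (suc t') _ t'<aⱼ) AA-LL =
    via u v (slot-aL (item t<aⱼ)) (slot-aL (item t'<aⱼ))
      (∣l+m-l+n∣≤o N (∣l+m-l+n∣≤o (W * toℕ (σ j))
        (within-block (offset<B (item t<aⱼ)) (offset<B (item t'<aⱼ)))))
  stretch u@(aL j (suc t) _ t<aⱼ) v@(aR _ (suc t') _ t'<aⱼ) AA-LR =
    via u v (slot-aL (item t<aⱼ)) (slot-aR (item t'<aⱼ))
      (∣l+m-l+n∣≤o N (∣l+m-k+[l+n]∣≤o (W * toℕ (σ j)) KW
        (across-halves (offset<B (item t<aⱼ)) (offset<B (item t'<aⱼ)))))
  stretch u@(aR j (suc t) _ t<aⱼ) v@(aR _ (suc t') _ t'<aⱼ) AA-RR =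
    via u v (slot-aR (item t<aⱼ)) (slot-aR (item t'<aⱼ))
      (∣l+m-l+n∣≤o N (∣l+m-l+n∣≤o KW (∣l+m-l+n∣≤o (W * toℕ (σ j))
        (within-block (offset<B (item t<aⱼ)) (offset<B (item t'<aⱼ))))))
  stretch u@(ℓ (suc i) (suc zero) _ i<k _ 1≤B) v@(x (suc p) _ p<N) (L1X m 1+i≤m _ x∈Xᵐ) =
    via′ u v (slot-ℓ i<k 1≤B) (slot-x p<N)
      (near-X p<N (first-delimiter<X 1+i≤m (X-start x∈Xᵐ)))
  stretch u@(x (suc p) _ p<N) v@(ℓ (suc i) (suc t) _ i<k _ t<B) (XL _ 1+p≡) =
    via u v (slot-x p<N) (slot-ℓ i<k t<B) (near-X p<N (delimiter<x t<B 1+p≡))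
  stretch u@(x (suc p) _ p<N) v@(ℓ (suc i) (suc t) _ i<k _ t<B) (XLk _ 1+p≡N) =
    via u v (slot-x p<N) (slot-ℓ i<k t<B)
      (near-last-x 1+p≡N (m<n⇒0<n t<B) (window<KW i<k (+-monoʳ-< B t<B)))
  stretch u@(x (suc p) _ p<N) v@(aL j (suc t) _ t<aⱼ) (XAL 1+p≡N) =
    via u v (slot-x p<N) (slot-aL (item t<aⱼ))
      (near-last-x 1+p≡N (m<n⇒0<n (offset<B (item t<aⱼ)))
        (window<KW (toℕ<n (σ j)) (offset<W (item t<aⱼ))))
  stretch u@(r (suc i) (suc t) _ i<k _ t<B) v@(y (suc p) _ p<N) (RBY m 1+t≡B _ m≤1+i y∈Yᵐ) =
    via u v (slot-r i<k t<B) (slot-y p<N)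
      (∣l+m-l+n∣≤o N (∣l+m-l+n∣≤o KW
        (near-Y (window<KW i<k (+-monoʳ-< B t<B)) (y<last-delimiter 1+t≡B m≤1+i (Y-end y∈Yᵐ)))))
  stretch u@(y (suc p) _ p<N) v@(r (suc i) (suc t) _ i<k _ t<B) (YR _ 1+p≡) =
    via′ u v (slot-y p<N) (slot-r i<k t<B)
      (∣l+m-l+n∣≤o N (∣l+m-l+n∣≤o KW
        (near-Y (window<KW i<k (+-monoʳ-< B t<B)) (y<delimiter 1+p≡))))
  stretch u@(y (suc zero) _ 0<N) v@(r (suc zero) (suc t) _ 0<k _ t<B) (YR1 refl refl) =
    via′ u v (slot-y 0<N) (slot-r 0<k t<B)
      (∣l+m-l+n∣≤o N (∣l+m-l+n∣≤o KW
        (near-first-y (m<n⇒0<n t<B) (window<KW 0<k (+-monoʳ-< B t<B)))))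
  stretch u@(y (suc zero) _ 0<N) v@(aR j (suc t) _ t<aⱼ) (YAR refl) =
    via′ u v (slot-y 0<N) (slot-aR (item t<aⱼ))
      (∣l+m-l+n∣≤o N (∣l+m-l+n∣≤o KW
        (near-first-y (m<n⇒0<n (offset<B (item t<aⱼ)))
          (window<KW (toℕ<n (σ j)) (offset<W (item t<aⱼ))))))

lemma14 : (n : ℕ) (a : Fin n → ℕ) (k B : ℕ) →
          1 ≤ k → k * B ≡ sumFin n a →
          BinPackingYes n a k B →
          BandwidthYes (Construction.V k B n a) (Construction.E k B n a)
            (Construction.b k B n a)
lemma14 n a k B _ _ (σ , σ-fills) = _ , ↔⇒⤖ ordering , stretch
  where open Ordering a k B σ σ-fills
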